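{- Let $K$ be an infinite field and $n\le r$ integers with $r\le 3n/2$. One can choose $R\in GL_r(K)$ and two diagonal matrices $D_1,D_2\in M_r(K)$ such that, writing $Z_i=R^{ -1}D_iR$ ($i=1,2$) and $B_i$ for the top-right $n\times(r-n)$ block of $Z_i$, the matrices $B_1,B_2$ have rank $r-n$ and $\operatorname{Im}(B_1)\cap\operatorname{Im}(B_2)=\{0\}$.
   Context: $\operatorname{Im}A$ denotes the column space of $A$. The top-right block of an $r\times r$ matrix consists of its first $n$ rows and last $r-n$ columns. -}

module Defs where

open import Level using (Level; _⊔_; suc)
open import Algebra.Bundles using (CommutativeRing)
open import Data.Nat using (ℕ; _≤_; _∸_; _+_)
open import Data.Nat.Properties using (m+[n∸m]≡n)
open import Data.Fin using (Fin; inject≤; _↑ʳ_; cast)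
open import Data.List using (List)
open import Data.List.Relation.Unary.All using (All)
open import Data.Product using (Σ; ∃; _×_)
open import Relation.Nullary using (¬_)
open import Relation.Binary.PropositionalEquality using (_≡_)
open import Function.Definitions using (Injective)

record Field (c ℓ : Level) : Set (Level.suc (c ⊔ ℓ)) where
  field
    commutativeRing : CommutativeRing c ℓ
  open CommutativeRing commutativeRing public
  field
    0≉1     : ¬ (0# ≈ 1#)
    inverse : ∀ x → ¬ (x ≈ 0#) → ∃ λ y → x * y ≈ 1#

module FieldDefs {c ℓ : Level} (F : Field c ℓ) where
  open Field F
  open import Algebra.Properties.Monoid.Sum +-monoid using (sum)

  Infinite : Set (c ⊔ ℓ)
  Infinite = (xs : List Carrier) → ∃ λ x → All (λ y → ¬ (x ≈ y)) xs

  Mat : ℕ → ℕ → Set c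
  Mat m n = Fin m → Fin n → Carrier

  Vect : ℕ → Set c
  Vect n = Fin n → Carrier

  _⊗_ : ∀ {m n p} → Mat m n → Mat n p → Mat m p
  (A ⊗ B) i k = sum (λ j → A i j * B j k)

  _·_ : ∀ {m n} → Mat m n → Vect n → Vect m
  (A · x) i = sum (λ j → A i j * x j)

  _≋_ : ∀ {m n} → Mat m n → Mat m n → Set ℓ
  A ≋ B = ∀ i j → A i j ≈ B i j

  _≈ᵥ_ : ∀ {n} → Vect n → Vect n → Set ℓ
  u ≈ᵥ v = ∀ i → u i ≈ v i

  0ᵥ : ∀ {n} → Vect n
  0ᵥ _ = 0#

  I : ∀ {n} → Mat n n
  I {n} i j with i Data.Fin.≟ j
  ... | Relation.Nullary.yes _ = 1#
  ... | Relation.Nullary.no _  = 0#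

  IsInverse : ∀ {n} → Mat n n → Mat n n → Set ℓ
  IsInverse R S = ((R ⊗ S) ≋ I) × ((S ⊗ R) ≋ I)

  IsDiagonal : ∀ {n} → Mat n n → Set (ℓ)
  IsDiagonal D = ∀ i j → ¬ (i ≡ j) → D i j ≈ 0#

  col : ∀ {m n} → Mat m n → Fin n → Vect m
  col A j i = A i j

  LinIndep : ∀ {m k} → (Fin k → Vect m) → Set (c ⊔ ℓ)
  LinIndep {m} {k} v =
    (a : Vect k) → (λ i → sum (λ j → a j * v j i)) ≈ᵥ 0ᵥ → a ≈ᵥ 0ᵥ

  HasRank : ∀ {m n} → Mat m n → ℕ → Set (c ⊔ ℓ)
  HasRank {m} {n} A k =
    (Σ (Fin k → Fin n) λ σ → Injective _≡_ _≡_ σ × LinIndep (λ t → col A (σ t)))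
    × ((σ : Fin (Data.Nat.suc k) → Fin n) → Injective _≡_ _≡_ σ →
        ¬ LinIndep (λ t → col A (σ t)))

  _∈Im_ : ∀ {m n} → Vect m → Mat m n → Set (c ⊔ ℓ)
  v ∈Im A = ∃ λ x → (A · x) ≈ᵥ v

  TrivialIntersection : ∀ {m n p} → Mat m n → Mat m p → Set (c ⊔ ℓ)
  TrivialIntersection A B = ∀ v → v ∈Im A → v ∈Im B → v ≈ᵥ 0ᵥ

  -- top-right n × (r - n) block of an r × r matrix (n ≤ r):
  -- first n rows, last r - n columns.
  topRight : ∀ {n r} → n ≤ r → Mat r r → Mat n (r ∸ n)
  topRight {n} {r} h Z i j = Z (inject≤ i h) (cast (m+[n∸m]≡n h) (n ↑ʳ j))

-- Let k = r − n, so 2k ≤ n. Take R = I + N where N vanishes outside the top-right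
-- n × k block and that block is [I_k; I_k; 0]. Then N² = 0, so R⁻¹ = I − N, and for a
-- diagonal D whose entries vanish past the first n, the top-right block of R⁻¹DR is
-- the block of N with row i scaled by D's i-th entry. Letting D₁, D₂ be the indicators
-- of the rows [0,k) and [k,n) cuts out the blocks [I_k; 0; 0] and [0; I_k; 0]: both
-- have rank k, and no row is nonzero in both, so their column spaces meet only in 0.
module Submission where

open import Defs
open import Level using (Level)
open import Data.Nat as ℕ using (ℕ; suc; _≤_; _<_; _∸_; _≤?_; _<?_)
import Data.Nat.Properties as ℕₚ
open import Data.Fin using (Fin; toℕ; fromℕ<; inject≤; cast; _↑ʳ_)
import Data.Fin.Properties as Finₚ
open import Data.Vec.Functional using (removeAt)
open import Data.Product using (Σ; _×_; _,_)
open import Data.Sum using (_⊎_; inj₁; inj₂)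
open import Function using (_∘_)
open import Function.Definitions using (Injective)
open import Relation.Nullary using (Dec; yes; no; ¬_; contradiction)
open import Relation.Nullary.Decidable using (_×-dec_)
open import Relation.Binary.PropositionalEquality as ≡ using (_≡_; _≢_)

module Matrices {c ℓ : Level} (F : Field c ℓ) where
  open Field F
  open FieldDefs F
  open import Algebra.Properties.Ring ring using (-0#≈0#; -‿distribʳ-*; -‿distribˡ-*)
  open import Algebra.Properties.CommutativeMonoid.Sum +-commutativeMonoid
    using (sum; sum-cong-≋; sum-replicate-zero; sum-remove; ∑-distrib-+)
  open import Relation.Binary.Reasoning.Setoid setoid

  indicator : ∀ {p} {P : Set p} → Dec P → Carrier
  indicator (yes _) = 1#
  indicator (no _)  = 0#

  indicator-*-+ : ∀ {p} {P : Set p} (P? : Dec P) {a b : Carrier} →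
                  (P → b ≈ 0#) → (¬ P → a ≈ 0#) → indicator P? * (a + b) ≈ a
  indicator-*-+ (yes p) b≈0 _   = trans (*-identityˡ _) (trans (+-congˡ (b≈0 p)) (+-identityʳ _))
  indicator-*-+ (no ¬p) _   a≈0 = trans (zeroˡ _) (sym (a≈0 ¬p))

  sum-zero : ∀ {m} (f : Vect m) → (∀ j → f j ≈ 0#) → sum f ≈ 0#
  sum-zero {m} f f≈0 = trans (sum-cong-≋ f≈0) (sum-replicate-zero m)

  sum-single : ∀ {m} (f : Vect m) (i : Fin m) → (∀ j → j ≢ i → f j ≈ 0#) → sum f ≈ f i
  sum-single {suc m} f i f≈0 = begin
    sum f                     ≈⟨ sum-remove {i = i} f ⟩
    f i + sum (removeAt f i)  ≈⟨ +-congˡ (sum-zero _ (λ j → f≈0 _ (Finₚ.punchInᵢ≢i i j))) ⟩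
    f i + 0#                  ≈⟨ +-identityʳ _ ⟩
    f i                       ∎

  I-diag : ∀ {m} (i : Fin m) → I i i ≈ 1#
  I-diag i with i Data.Fin.≟ i
  ... | yes _  = refl
  ... | no i≢i = contradiction ≡.refl i≢i

  I-off : ∀ {m} {i j : Fin m} → i ≢ j → I i j ≈ 0#
  I-off {i = i} {j} i≢j with i Data.Fin.≟ j
  ... | yes i≡j = contradiction i≡j i≢j
  ... | no _    = refl

  ⊗-identityˡ : ∀ {m n} (A : Mat m n) → (I ⊗ A) ≋ A
  ⊗-identityˡ A i j = begin
    sum (λ t → I i t * A t j)
      ≈⟨ sum-single _ i (λ t t≢i → trans (*-congʳ (I-off (t≢i ∘ ≡.sym))) (zeroˡ _)) ⟩
    I i i * A i j              ≈⟨ *-congʳ (I-diag i) ⟩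
    1# * A i j                 ≈⟨ *-identityˡ _ ⟩
    A i j                      ∎

  ⊗-identityʳ : ∀ {m n} (A : Mat m n) → (A ⊗ I) ≋ A
  ⊗-identityʳ A i j = begin
    sum (λ t → A i t * I t j)  ≈⟨ sum-single _ j (λ t t≢j → trans (*-congˡ (I-off t≢j)) (zeroʳ _)) ⟩
    A i j * I j j              ≈⟨ *-congˡ (I-diag j) ⟩
    A i j * 1#                 ≈⟨ *-identityʳ _ ⟩
    A i j                      ∎

  diag : ∀ {m} → Vect m → Mat m m
  diag d i j = d i * I i j

  diag-isDiagonal : ∀ {m} (d : Vect m) → IsDiagonal (diag d)
  diag-isDiagonal d i j i≢j = trans (*-congˡ (I-off i≢j)) (zeroʳ _)

  ⊗-diagʳ : ∀ {m p} (A : Mat m p) (d : Vect p) i j → (A ⊗ diag d) i j ≈ A i j * d j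
  ⊗-diagʳ A d i j = begin
    sum (λ t → A i t * (d t * I t j))
      ≈⟨ sum-single _ j (λ t t≢j → trans (*-congˡ (trans (*-congˡ (I-off t≢j)) (zeroʳ _))) (zeroʳ _)) ⟩
    A i j * (d j * I j j)  ≈⟨ *-congˡ (trans (*-congˡ (I-diag j)) (*-identityʳ _)) ⟩
    A i j * d j            ∎

  infixl 6 _⊕_
  infix  8 ⊖_

  _⊕_ : ∀ {m n} → Mat m n → Mat m n → Mat m n
  (A ⊕ B) i j = A i j + B i j

  ⊖_ : ∀ {m n} → Mat m n → Mat m n
  (⊖ A) i j = - A i j

  I⊕-⊗-I⊕ : ∀ {m} (A B : Mat m m) → (∀ i t j → A i t * B t j ≈ 0#) →
            ((I ⊕ A) ⊗ (I ⊕ B)) ≋ (I ⊕ (A ⊕ B))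
  I⊕-⊗-I⊕ A B AB≈0 i j = begin
    sum (λ t → (I i t + A i t) * (I t j + B t j))  ≈⟨ sum-cong-≋ expand ⟩
    sum (λ t → I i t * (I t j + B t j) + A i t * I t j)
      ≈⟨ ∑-distrib-+ (λ t → I i t * (I t j + B t j)) (λ t → A i t * I t j) ⟩
    (I ⊗ (I ⊕ B)) i j + (A ⊗ I) i j  ≈⟨ +-cong (⊗-identityˡ (I ⊕ B) i j) (⊗-identityʳ A i j) ⟩
    (I i j + B i j) + A i j          ≈⟨ +-assoc _ _ _ ⟩
    I i j + (B i j + A i j)          ≈⟨ +-congˡ (+-comm _ _) ⟩
    I i j + (A i j + B i j)          ∎
    where
    expand : ∀ t → (I i t + A i t) * (I t j + B t j) ≈ I i t * (I t j + B t j) + A i t * I t j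
    expand t = begin
      (I i t + A i t) * (I t j + B t j)
        ≈⟨ distribʳ _ _ _ ⟩
      I i t * (I t j + B t j) + A i t * (I t j + B t j)
        ≈⟨ +-congˡ (distribˡ _ _ _) ⟩
      I i t * (I t j + B t j) + (A i t * I t j + A i t * B t j)
        ≈⟨ +-congˡ (trans (+-congˡ (AB≈0 i t j)) (+-identityʳ _)) ⟩
      I i t * (I t j + B t j) + A i t * I t j
        ∎

  unipotent-inverse : ∀ {m} (N : Mat m m) → (∀ i t j → N i t * N t j ≈ 0#) →
                      IsInverse (I ⊕ N) (I ⊕ ⊖ N)
  unipotent-inverse N N²≈0 =
    (λ i j → trans (I⊕-⊗-I⊕ N (⊖ N) N⊖N≈0 i j) (cancel (-‿inverseʳ _))) ,
    (λ i j → trans (I⊕-⊗-I⊕ (⊖ N) N ⊖NN≈0 i j) (cancel (-‿inverseˡ _)))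
    where
    cancel : ∀ {x y} → y ≈ 0# → x + y ≈ x
    cancel y≈0 = trans (+-congˡ y≈0) (+-identityʳ _)
    N⊖N≈0 : ∀ i t j → N i t * - N t j ≈ 0#
    N⊖N≈0 i t j = trans (sym (-‿distribʳ-* _ _)) (trans (-‿cong (N²≈0 i t j)) -0#≈0#)
    ⊖NN≈0 : ∀ i t j → - N i t * N t j ≈ 0#
    ⊖NN≈0 i t j = trans (sym (-‿distribˡ-* _ _)) (trans (-‿cong (N²≈0 i t j)) -0#≈0#)

  SupportedInTopRight : ∀ {r} → ℕ → Mat r r → Set ℓ
  SupportedInTopRight n N = ∀ i j → n ≤ toℕ i ⊎ toℕ j < n → N i j ≈ 0#

  supportedInTopRight-square-zero : ∀ {n r} (N : Mat r r) → SupportedInTopRight n N →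
                                    ∀ i t j → N i t * N t j ≈ 0#
  supportedInTopRight-square-zero {n} N N-supp i t j with toℕ t <? n
  ... | yes t<n = trans (*-congʳ (N-supp i t (inj₂ t<n))) (zeroˡ _)
  ... | no  t≮n = trans (*-congˡ (N-supp t j (inj₁ (ℕₚ.≮⇒≥ t≮n)))) (zeroʳ _)

  -- d must vanish past n, or the summand t = j would contribute - N i j * d j.
  conjugate-diag-entry : ∀ {n r} (N : Mat r r) (d : Vect r) → SupportedInTopRight n N →
                         (∀ x → n ≤ toℕ x → d x ≈ 0#) →
                         ∀ i j → n ≤ toℕ j →
                         (((I ⊕ ⊖ N) ⊗ diag d) ⊗ (I ⊕ N)) i j ≈ d i * N i j
  conjugate-diag-entry {n} N d N-supp d-supp i j n≤j = begin
    sum (λ t → ((I ⊕ ⊖ N) ⊗ diag d) i t * (I t j + N t j))  ≈⟨ sum-cong-≋ term ⟩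
    (I ⊗ (λ t j → d t * N t j)) i j                          ≈⟨ ⊗-identityˡ (λ t j → d t * N t j) i j ⟩
    d i * N i j                                              ∎
    where
    term : ∀ t → ((I ⊕ ⊖ N) ⊗ diag d) i t * (I t j + N t j) ≈ I i t * (d t * N t j)
    term t with toℕ t <? n
    ... | yes t<n = begin
      ((I ⊕ ⊖ N) ⊗ diag d) i t * (I t j + N t j)  ≈⟨ *-congʳ (⊗-diagʳ (I ⊕ ⊖ N) d i t) ⟩
      (I i t + - N i t) * d t * (I t j + N t j)   ≈⟨ *-cong (*-congʳ I⊖N≈I) I⊕N≈N ⟩
      I i t * d t * N t j                         ≈⟨ *-assoc _ _ _ ⟩
      I i t * (d t * N t j)                       ∎
      where
      I⊖N≈I : I i t + - N i t ≈ I i t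
      I⊖N≈I = trans (+-congˡ (trans (-‿cong (N-supp i t (inj₂ t<n))) -0#≈0#)) (+-identityʳ _)
      I⊕N≈N : I t j + N t j ≈ N t j
      I⊕N≈N = trans (+-congʳ (I-off {i = t} {j} (λ { ≡.refl → ℕₚ.<⇒≱ t<n n≤j }))) (+-identityˡ _)
    ... | no t≮n = begin
      ((I ⊕ ⊖ N) ⊗ diag d) i t * (I t j + N t j)  ≈⟨ *-congʳ (⊗-diagʳ (I ⊕ ⊖ N) d i t) ⟩
      (I i t + - N i t) * d t * (I t j + N t j)   ≈⟨ *-congʳ (trans (*-congˡ dₜ≈0) (zeroʳ _)) ⟩
      0# * (I t j + N t j)                        ≈⟨ zeroˡ _ ⟩
      0#                                          ≈⟨ sym (trans (*-congˡ (trans (*-congʳ dₜ≈0) (zeroˡ _))) (zeroʳ _)) ⟩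
      I i t * (d t * N t j)                       ∎
      where
      dₜ≈0 : d t ≈ 0#
      dₜ≈0 = d-supp t (ℕₚ.≮⇒≥ t≮n)

  topRightColumn : ∀ {n r} → n ≤ r → Fin (r ∸ n) → Fin r
  topRightColumn {n} h t = cast (ℕₚ.m+[n∸m]≡n h) (n ↑ʳ t)

  toℕ-topRightColumn : ∀ {n r} (h : n ≤ r) (t : Fin (r ∸ n)) → toℕ (topRightColumn h t) ≡ n ℕ.+ toℕ t
  toℕ-topRightColumn {n} h t = ≡.trans (Finₚ.toℕ-cast _ (n ↑ʳ t)) (Finₚ.toℕ-↑ʳ n t)

  n≤topRightColumn : ∀ {n r} (h : n ≤ r) (t : Fin (r ∸ n)) → n ≤ toℕ (topRightColumn h t)
  n≤topRightColumn {n} h t = ≡.subst (n ≤_) (≡.sym (toℕ-topRightColumn h t)) (ℕₚ.m≤m+n n (toℕ t))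

  topRight-conjugate-diag : ∀ {n r} (h : n ≤ r) (N : Mat r r) (d : Vect r) → SupportedInTopRight n N →
                            (∀ x → n ≤ toℕ x → d x ≈ 0#) → ∀ i t →
                            topRight h (((I ⊕ ⊖ N) ⊗ diag d) ⊗ (I ⊕ N)) i t
                              ≈ d (inject≤ i h) * topRight h N i t
  topRight-conjugate-diag {n} h N d N-supp d-supp i t =
    conjugate-diag-entry N d N-supp d-supp (inject≤ i h) (topRightColumn h t)
      (n≤topRightColumn h t)

  fromTopRight : ∀ {n r} → Mat n (r ∸ n) → Mat r r
  fromTopRight {n} B i j with toℕ i <? n | n ≤? toℕ j
  ... | yes i<n | yes n≤j = B (fromℕ< i<n) (fromℕ< (ℕₚ.∸-monoˡ-< (Finₚ.toℕ<n j) n≤j))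
  ... | _       | _       = 0#

  fromTopRight-supported : ∀ {n r} (B : Mat n (r ∸ n)) → SupportedInTopRight n (fromTopRight B)
  fromTopRight-supported {n} B i j outside with toℕ i <? n | n ≤? toℕ j | outside
  ... | yes i<n | yes _   | inj₁ n≤i = contradiction n≤i (ℕₚ.<⇒≱ i<n)
  ... | yes _   | yes n≤j | inj₂ j<n = contradiction n≤j (ℕₚ.<⇒≱ j<n)
  ... | yes _   | no  _   | _        = refl
  ... | no  _   | _       | _        = refl

  topRight-fromTopRight : ∀ {n r} (h : n ≤ r) (B : Mat n (r ∸ n)) → topRight h (fromTopRight B) ≋ B
  topRight-fromTopRight {n} {r} h B i t with toℕ (inject≤ i h) <? n | n ≤? toℕ (topRightColumn h t)
  ... | yes i<n | yes _ = reflexive (≡.cong₂ B row (column _))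
    where
    row : fromℕ< i<n ≡ i
    row = Finₚ.toℕ-injective (≡.trans (Finₚ.toℕ-fromℕ< i<n) (Finₚ.toℕ-inject≤ i h))
    column : .(t<k : toℕ (topRightColumn h t) ∸ n < r ∸ n) → fromℕ< t<k ≡ t
    column t<k = Finₚ.toℕ-injective (≡.trans (Finₚ.toℕ-fromℕ< t<k)
      (≡.trans (≡.cong (_∸ n) (toℕ-topRightColumn h t)) (ℕₚ.m+n∸m≡n n (toℕ t))))
  ... | no i≮n | _ =
    contradiction (≡.subst (_< n) (≡.sym (Finₚ.toℕ-inject≤ i h)) (Finₚ.toℕ<n i)) i≮n
  ... | yes _ | no n≰j =
    contradiction (n≤topRightColumn h t) n≰j

  HasRank-of-LinIndep : ∀ {m k} (B : Mat m k) → LinIndep (col B) → HasRank B k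
  HasRank-of-LinIndep {k = k} B indep = ((λ t → t) , (λ eq → eq) , indep) , noLarger
    where
    noLarger : (σ : Fin (suc k) → Fin k) → Injective _≡_ _≡_ σ → ¬ LinIndep (λ t → col B (σ t))
    noLarger σ σ-injective _ with Finₚ.pigeonhole (ℕₚ.n<1+n k) σ
    ... | x , y , x<y , σx≡σy = Finₚ.<-irrefl (σ-injective σx≡σy) x<y

  LinIndep-basisColumns : ∀ {m k} (B : Mat m k) (ρ : Fin k → Fin m) → Injective _≡_ _≡_ ρ →
                          (∀ i t → B i t ≈ I i (ρ t)) → LinIndep (col B)
  LinIndep-basisColumns B ρ ρ-injective B≈ a combination≈0 u = begin
    a u                          ≈⟨ sym (*-identityʳ _) ⟩
    a u * 1#                     ≈⟨ *-congˡ (sym (trans (B≈ (ρ u) u) (I-diag (ρ u)))) ⟩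
    a u * B (ρ u) u              ≈⟨ sym (sum-single _ u off-u) ⟩
    sum (λ t → a t * B (ρ u) t)  ≈⟨ combination≈0 (ρ u) ⟩
    0#                           ∎
    where
    off-u : ∀ t → t ≢ u → a t * B (ρ u) t ≈ 0#
    off-u t t≢u =
      trans (*-congˡ (trans (B≈ (ρ u) t) (I-off (λ ρu≡ρt → t≢u (≡.sym (ρ-injective ρu≡ρt)))))) (zeroʳ _)

  TrivialIntersection-of-disjointRows : ∀ {m p q} (A : Mat m p) (B : Mat m q) →
                                        (∀ i → (∀ j → A i j ≈ 0#) ⊎ (∀ j → B i j ≈ 0#)) →
                                        TrivialIntersection A B
  TrivialIntersection-of-disjointRows A B rows v (x , Ax≈v) (y , By≈v) i with rows i
  ... | inj₁ Aᵢ≈0 = trans (sym (Ax≈v i)) (sum-zero _ (λ j → trans (*-congʳ (Aᵢ≈0 j)) (zeroˡ _)))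
  ... | inj₂ Bᵢ≈0 = trans (sym (By≈v i)) (sum-zero _ (λ j → trans (*-congʳ (Bᵢ≈0 j)) (zeroˡ _)))

module Construction {c ℓ : Level} (F : Field c ℓ) {n r : ℕ} (h : n ≤ r)
                    (k+k≤n : (r ∸ n) ℕ.+ (r ∸ n) ≤ n) where
  open Field F
  open FieldDefs F
  open Matrices F

  k : ℕ
  k = r ∸ n

  k≤n : k ≤ n
  k≤n = ℕₚ.≤-trans (ℕₚ.m≤m+n k k) k+k≤n

  ι₁ ι₂ : Fin k → Fin n
  ι₁ t = inject≤ t k≤n
  ι₂ t = fromℕ< (ℕₚ.<-≤-trans (ℕₚ.+-monoʳ-< k (Finₚ.toℕ<n t)) k+k≤n)

  toℕ-ι₁ : ∀ t → toℕ (ι₁ t) ≡ toℕ t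
  toℕ-ι₁ t = Finₚ.toℕ-inject≤ t k≤n

  toℕ-ι₂ : ∀ t → toℕ (ι₂ t) ≡ k ℕ.+ toℕ t
  toℕ-ι₂ t = Finₚ.toℕ-fromℕ< _

  ι₁-injective : Injective _≡_ _≡_ ι₁
  ι₁-injective {s} {t} = Finₚ.inject≤-injective k≤n k≤n s t

  ι₂-injective : Injective _≡_ _≡_ ι₂
  ι₂-injective {s} {t} eq = Finₚ.toℕ-injective (ℕₚ.+-cancelˡ-≡ k _ _
    (≡.trans (≡.sym (toℕ-ι₂ s)) (≡.trans (≡.cong toℕ eq) (toℕ-ι₂ t))))

  I-ι₁ : ∀ {i t} → k ≤ toℕ i → I i (ι₁ t) ≈ 0#
  I-ι₁ {i} {t} k≤i = I-off {i = i} {ι₁ t} λ { ≡.refl →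
    ℕₚ.<⇒≱ (≡.subst (_< k) (≡.sym (toℕ-ι₁ t)) (Finₚ.toℕ<n t)) k≤i }

  I-ι₂ : ∀ {i t} → toℕ i < k → I i (ι₂ t) ≈ 0#
  I-ι₂ {i} {t} i<k = I-off {i = i} {ι₂ t} λ { ≡.refl →
    ℕₚ.<⇒≱ i<k (≡.subst (k ≤_) (≡.sym (toℕ-ι₂ t)) (ℕₚ.m≤m+n k (toℕ t))) }

  E : Mat n k
  E i t = I i (ι₁ t) + I i (ι₂ t)

  N : Mat r r
  N = fromTopRight E

  d₁ d₂ : Vect r
  d₁ x = indicator (toℕ x <? k)
  d₂ x = indicator (k ≤? toℕ x ×-dec toℕ x <? n)

  d₁-supported : ∀ x → n ≤ toℕ x → d₁ x ≈ 0#
  d₁-supported x n≤x with toℕ x <? k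
  ... | yes x<k = contradiction n≤x (ℕₚ.<⇒≱ (ℕₚ.<-≤-trans x<k k≤n))
  ... | no  _   = refl

  d₂-supported : ∀ x → n ≤ toℕ x → d₂ x ≈ 0#
  d₂-supported x n≤x with k ≤? toℕ x ×-dec toℕ x <? n
  ... | yes (_ , x<n) = contradiction n≤x (ℕₚ.<⇒≱ x<n)
  ... | no  _         = refl

  Z : Vect r → Mat r r
  Z d = ((I ⊕ ⊖ N) ⊗ diag d) ⊗ (I ⊕ N)

  topRight-Z : ∀ d → (∀ x → n ≤ toℕ x → d x ≈ 0#) → ∀ i t →
               topRight h (Z d) i t ≈ d (inject≤ i h) * E i t
  topRight-Z d d-supported i t =
    trans (topRight-conjugate-diag h N d (fromTopRight-supported E) d-supported i t)
          (*-congˡ (topRight-fromTopRight h E i t))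

  topRight-Z₁ : ∀ i t → topRight h (Z d₁) i t ≈ I i (ι₁ t)
  topRight-Z₁ i t = trans (topRight-Z d₁ d₁-supported i t)
    (indicator-*-+ (toℕ (inject≤ i h) <? k)
      (λ i<k → I-ι₂ (≡.subst (_< k) (Finₚ.toℕ-inject≤ i h) i<k))
      (λ i≮k → I-ι₁ (ℕₚ.≮⇒≥ (i≮k ∘ ≡.subst (_< k) (≡.sym (Finₚ.toℕ-inject≤ i h))))))

  topRight-Z₂ : ∀ i t → topRight h (Z d₂) i t ≈ I i (ι₂ t)
  topRight-Z₂ i t = trans (topRight-Z d₂ d₂-supported i t) (trans (*-congˡ (+-comm _ _))
    (indicator-*-+ (k ≤? toℕ (inject≤ i h) ×-dec toℕ (inject≤ i h) <? n)
      (λ (k≤i , _) → I-ι₁ (≡.subst (k ≤_) (Finₚ.toℕ-inject≤ i h) k≤i))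
      (λ ¬k≤i<n → I-ι₂ (ℕₚ.≰⇒> λ k≤i → ¬k≤i<n
        ( ≡.subst (k ≤_) (≡.sym (Finₚ.toℕ-inject≤ i h)) k≤i
        , ≡.subst (_< n) (≡.sym (Finₚ.toℕ-inject≤ i h)) (Finₚ.toℕ<n i))))))

  disjoint-rows : ∀ i → (∀ t → topRight h (Z d₁) i t ≈ 0#) ⊎ (∀ t → topRight h (Z d₂) i t ≈ 0#)
  disjoint-rows i with toℕ i <? k
  ... | yes i<k = inj₂ (λ t → trans (topRight-Z₂ i t) (I-ι₂ i<k))
  ... | no  i≮k = inj₁ (λ t → trans (topRight-Z₁ i t) (I-ι₁ (ℕₚ.≮⇒≥ i≮k)))

open import Data.Nat using (_*_; _+_)

excess-bound : ∀ n r → 2 * r ≤ 3 * n → (r ∸ n) + (r ∸ n) ≤ n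
excess-bound n r 2r≤3n = begin
  (r ∸ n) + (r ∸ n)      ≡⟨ ≡.cong ((r ∸ n) +_) (≡.sym (ℕₚ.+-identityʳ (r ∸ n))) ⟩
  2 * (r ∸ n)            ≡⟨ ℕₚ.*-distribˡ-∸ 2 r n ⟩
  2 * r ∸ 2 * n          ≤⟨ ℕₚ.∸-monoˡ-≤ (2 * n) 2r≤3n ⟩
  3 * n ∸ 2 * n          ≡⟨ ≡.cong (_∸ 2 * n) (ℕₚ.+-comm n (2 * n)) ⟩
  2 * n + n ∸ 2 * n      ≡⟨ ℕₚ.m+n∸m≡n (2 * n) n ⟩
  n                      ∎
  where open ℕₚ.≤-Reasoning

proposition2 : {c ℓ : Level} (F : Field c ℓ) → FieldDefs.Infinite F →
    (n r : ℕ) (h : n ≤ r) → 2 * r ≤ 3 * n →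
    let open FieldDefs F in
    Σ (Mat r r) λ R → Σ (Mat r r) λ Rinv → Σ (Mat r r) λ D₁ → Σ (Mat r r) λ D₂ →
      IsInverse R Rinv × IsDiagonal D₁ × IsDiagonal D₂ ×
      HasRank (topRight h ((Rinv ⊗ D₁) ⊗ R)) (r ∸ n) ×
      HasRank (topRight h ((Rinv ⊗ D₂) ⊗ R)) (r ∸ n) ×
      TrivialIntersection (topRight h ((Rinv ⊗ D₁) ⊗ R)) (topRight h ((Rinv ⊗ D₂) ⊗ R))
proposition2 F _ n r h 2r≤3n =
  I ⊕ N , I ⊕ ⊖ N , diag d₁ , diag d₂ ,
  unipotent-inverse N (supportedInTopRight-square-zero N (fromTopRight-supported E)) ,
  diag-isDiagonal d₁ , diag-isDiagonal d₂ ,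
  HasRank-of-LinIndep _ (LinIndep-basisColumns _ ι₁ ι₁-injective topRight-Z₁) ,
  HasRank-of-LinIndep _ (LinIndep-basisColumns _ ι₂ ι₂-injective topRight-Z₂) ,
  TrivialIntersection-of-disjointRows _ _ disjoint-rows
  where
  open FieldDefs F
  open Matrices F
  open Construction F h (excess-bound n r 2r≤3n)
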